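{- For every (finite, simple, loopless, undirected) graph $G$, we have $\mathrm{lin}(G)-1\leq \mathrm{lin}^o(G)\leq 2\,\mathrm{lin}(G)$.
   Context: For a graph $G=(V,E)$ and a vertex $x$, $N(x)$ denotes the open neighbourhood of $x$ and $N[x]=N(x)\cup\{x\}$ the closed neighbourhood. A closed (resp. open) $p$-line-model of $G$ is a tuple $(\sigma_1,\ldots,\sigma_p)$ of linear orders on $V$ such that for every vertex $x\in V$ there exist $I_1,\ldots,I_p$ with each $I_i$ an interval of $\sigma_i$ (possibly empty; the intervals need not be disjoint) and $N[x]=\bigcup_{i=1}^p I_i$ (resp. $N(x)=\bigcup_{i=1}^p I_i$). The closed linearity $\mathrm{lin}(G)$ (resp. open linearity $\mathrm{lin}^o(G)$) is the minimum $p$ such that a closed (resp. open) $p$-line-model of $G$ exists. -}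

module Defs where

open import Level using (0ℓ)
open import Data.Nat using (ℕ; _≤_)
open import Data.Fin using (Fin)
open import Data.Fin.Permutation using (Permutation′; _⟨$⟩ʳ_)
open import Data.Maybe using (Maybe; just; nothing)
open import Data.Product using (Σ; _×_; _,_; ∃)
open import Data.Sum using (_⊎_)
open import Data.Empty using (⊥)
open import Relation.Nullary using (¬_)
open import Relation.Binary.PropositionalEquality using (_≡_)
open import Function.Bundles using (_⇔_)

record Graph (n : ℕ) : Set₁ where
  field
    Adj     : Fin n → Fin n → Set
    sym     : ∀ {x y} → Adj x y → Adj y x
    irrefl  : ∀ x → ¬ Adj x x

N[_]_∋_ : ∀ {n} → Graph n → Fin n → Fin n → Set
N[ G ] x ∋ v = Adj x v
  where open Graph G

Nc[_]_∋_ : ∀ {n} → Graph n → Fin n → Fin n → Set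
Nc[ G ] x ∋ v = Graph.Adj G x v ⊎ v ≡ x

-- A linear order on Fin n, given as a bijection vertex ↦ position.
LinOrder : ℕ → Set
LinOrder n = Permutation′ n

-- An interval of a linear order: either empty, or given by two end
-- positions a, b (containing the vertices whose position lies in [a,b]).
Interval : ℕ → Set
Interval n = Maybe (Fin n × Fin n)

_∈I[_,_] : ∀ {n} → Fin n → LinOrder n → Interval n → Set
v ∈I[ σ , nothing ] = ⊥
v ∈I[ σ , just (a , b) ] = (a Data.Fin.≤ (σ ⟨$⟩ʳ v)) × ((σ ⟨$⟩ʳ v) Data.Fin.≤ b)

LineModel : ∀ {n} → (Fin n → Fin n → Set) → ℕ → Set
LineModel {n} Nb p =
  Σ (Fin p → LinOrder n) λ σ →
    ∀ (x : Fin n) → Σ (Fin p → Interval n) λ I →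
      ∀ (v : Fin n) → Nb x v ⇔ ∃ λ (i : Fin p) → v ∈I[ σ i , I i ]

ClosedLineModel OpenLineModel : ∀ {n} → Graph n → ℕ → Set
ClosedLineModel G p = LineModel (Nc[ G ]_∋_) p
OpenLineModel   G p = LineModel (N[ G ]_∋_) p

IsMinimum : (ℕ → Set) → ℕ → Set
IsMinimum P m = P m × (∀ p → P p → m ≤ p)

IsLin IsOpenLin : ∀ {n} → Graph n → ℕ → Set
IsLin     G m = IsMinimum (ClosedLineModel G) m
IsOpenLin G m = IsMinimum (OpenLineModel G) m

module Submission where

open import Defs
open import Data.Nat using (ℕ; _≤_; _∸_; _*_)
open import Data.Product using (_×_)

-- Both inequalities come from converting one kind of line model
-- into the other.
--  * lin(G) ≤ lin°(G) + 1: from an open model, add one extra linear order in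
--    which every closed neighbourhood N[x] = N(x) ∪ {x} gains the singleton
--    interval {x} (lemma add-centre).
--  * lin°(G) ≤ 2·lin(G): in a closed model, x lies in some of the intervals
--    covering N[x].  Cutting every interval at the position of x into the part
--    before x and the part after x (lemma puncture) yields 2·lin(G) orders
--    whose intervals cover exactly N[x] ∖ {x} = N(x) (lemma remove-centre).

open import Data.Nat using (zero; suc; _+_; _<_; _⊓_; _⊔_; s≤s; s≤s⁻¹; z≤n; _<?_)
open import Data.Nat.Properties
  using ( ≤-refl; ≤-trans; ≤-<-trans; ≤-antisym; <⇒≢; <-cmp; +-identityʳ; ∸-monoˡ-≤
        ; ⊔-lub; ⊓-glb; m≤m⊔n; m≤n⊔m; m⊓n≤m; m⊓n≤n)
open import Data.Fin as Fin using (Fin; toℕ; fromℕ<; splitAt; join)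
open import Data.Fin.Properties using (toℕ-fromℕ<; toℕ-injective; toℕ<n; splitAt-join)
open import Data.Fin.Permutation using (_⟨$⟩ʳ_; _⟨$⟩ˡ_; inverseˡ)
import Data.Fin.Permutation as Permutation
open import Data.Maybe using (just; nothing)
open import Data.Product using (Σ; _,_; proj₁; proj₂; ∃)
open import Data.Sum using (_⊎_; inj₁; inj₂)
open import Data.Empty using (⊥-elim)
open import Relation.Nullary using (¬_; yes; no)
open import Relation.Binary using (tri<; tri≈; tri>)
open import Relation.Binary.PropositionalEquality using (_≡_; refl; sym; cong; subst; module ≡-Reasoning)
open import Function.Bundles using (_⇔_; mk⇔; Equivalence)

open import Function.Properties.Equivalence using () renaming (sym to ⇔-sym; trans to ⇔-trans)

open Equivalence using (to; from)

pos : ∀ {n} → LinOrder n → Fin n → ℕ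
pos σ v = toℕ (σ ⟨$⟩ʳ v)

pos-injective : ∀ {n} (σ : LinOrder n) {v w : Fin n} → pos σ v ≡ pos σ w → v ≡ w
pos-injective σ {v} {w} eq = begin
  v                      ≡⟨ sym (inverseˡ σ) ⟩
  σ ⟨$⟩ˡ (σ ⟨$⟩ʳ v)      ≡⟨ cong (σ ⟨$⟩ˡ_) (toℕ-injective eq) ⟩
  σ ⟨$⟩ˡ (σ ⟨$⟩ʳ w)      ≡⟨ inverseˡ σ ⟩
  w                      ∎
  where open ≡-Reasoning

range : ∀ {n} → ℕ → ℕ → Interval n
range {zero}  lo hi      = nothing
range {suc m} lo zero    = nothing
range {suc m} lo (suc h) with lo <? suc m
... | yes lo<n = just (fromℕ< lo<n , fromℕ< (s≤s (m⊓n≤n h m)))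
... | no  _    = nothing

range-correct : ∀ {n} (lo hi : ℕ) (σ : LinOrder n) (v : Fin n) →
  v ∈I[ σ , range lo hi ] ⇔ (lo ≤ pos σ v × pos σ v < hi)
range-correct {zero}  lo hi      σ ()
range-correct {suc m} lo zero    σ v = mk⇔ (λ ()) (λ ())
range-correct {suc m} lo (suc h) σ v with lo <? suc m
... | yes lo<n = mk⇔
  (λ (a , b) → subst (_≤ pos σ v) (toℕ-fromℕ< lo<n) a
             , s≤s (≤-trans (subst (pos σ v ≤_) (toℕ-fromℕ< _) b) (m⊓n≤m h m)))
  (λ (a , b) → subst (_≤ pos σ v) (sym (toℕ-fromℕ< lo<n)) a
             , subst (pos σ v ≤_) (sym (toℕ-fromℕ< _))
                 (⊓-glb (s≤s⁻¹ b) (s≤s⁻¹ (toℕ<n (σ ⟨$⟩ʳ v)))))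
... | no lo≮n = mk⇔ (λ ()) (λ (a , _) → lo≮n (≤-<-trans a (toℕ<n (σ ⟨$⟩ʳ v))))

restrict : ∀ {n} → Interval n → ℕ → ℕ → Interval n
restrict nothing        lo hi = nothing
restrict (just (a , b)) lo hi = range (toℕ a ⊔ lo) (suc (toℕ b) ⊓ hi)

restrict-correct : ∀ {n} (I : Interval n) (lo hi : ℕ) (σ : LinOrder n) (v : Fin n) →
  v ∈I[ σ , restrict I lo hi ] ⇔ (v ∈I[ σ , I ] × lo ≤ pos σ v × pos σ v < hi)
restrict-correct nothing        lo hi σ v = mk⇔ (λ ()) (λ { (() , _) })
restrict-correct (just (a , b)) lo hi σ v = mk⇔
  (λ w → let (x , y) = to (range-correct _ _ σ v) w in
         (≤-trans (m≤m⊔n _ lo) x , s≤s⁻¹ (≤-trans y (m⊓n≤m _ hi)))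
       , ≤-trans (m≤n⊔m _ lo) x , ≤-trans y (m⊓n≤n _ hi))
  (λ ((x , y) , z , u) → from (range-correct _ _ σ v) (⊔-lub x z , ⊓-glb (s≤s y) u))

before after : ∀ {n} → Interval n → ℕ → Interval n
before I s = restrict I 0 s
after {n} I s = restrict I (suc s) n

puncture : ∀ {n} (σ : LinOrder n) (I : Interval n) (s : ℕ) (v : Fin n) →
  (v ∈I[ σ , I ] × ¬ pos σ v ≡ s) ⇔ (v ∈I[ σ , before I s ] ⊎ v ∈I[ σ , after I s ])
puncture σ I s v = mk⇔ split glue
  where
  split : v ∈I[ σ , I ] × ¬ pos σ v ≡ s → v ∈I[ σ , before I s ] ⊎ v ∈I[ σ , after I s ]
  split (m , ne) with <-cmp (pos σ v) s
  ... | tri< lt _ _ = inj₁ (from (restrict-correct I 0 s σ v) (m , z≤n , lt))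
  ... | tri≈ _ eq _ = ⊥-elim (ne eq)
  ... | tri> _ _ gt = inj₂ (from (restrict-correct I _ _ σ v) (m , gt , toℕ<n (σ ⟨$⟩ʳ v)))
  glue : v ∈I[ σ , before I s ] ⊎ v ∈I[ σ , after I s ] → v ∈I[ σ , I ] × ¬ pos σ v ≡ s
  glue (inj₁ w) = let (m , _ , lt) = to (restrict-correct I _ _ σ v) w in m , <⇒≢ lt
  glue (inj₂ w) = let (m , gt , _) = to (restrict-correct I _ _ σ v) w in m , λ eq → <⇒≢ gt (sym eq)

LineModelOn : ∀ {n} → (Fin n → Fin n → Set) → Set → Set
LineModelOn {n} Nb A =
  Σ (A → LinOrder n) λ σ →
    ∀ (x : Fin n) → Σ (A → Interval n) λ I →
      ∀ (v : Fin n) → Nb x v ⇔ ∃ λ (i : A) → v ∈I[ σ i , I i ]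

reindex : ∀ {n} {Nb : Fin n → Fin n → Set} {A B : Set} (g : B → A) (h : A → B) →
  (∀ a → g (h a) ≡ a) → LineModelOn Nb A → LineModelOn Nb B
reindex g h g∘h≡id (σ , f) = (λ b → σ (g b)) , λ x → (λ b → proj₁ (f x) (g b)) , λ v →
  mk⇔ (λ nb → let (a , m) = to (proj₂ (f x) v) nb in
              h a , subst (λ a → v ∈I[ σ a , proj₁ (f x) a ]) (sym (g∘h≡id a)) m)
      (λ (b , m) → from (proj₂ (f x) v) (g b , m))

model-cong : ∀ {n} {Nb Nb′ : Fin n → Fin n → Set} {A : Set} →
  (∀ x v → Nb x v ⇔ Nb′ x v) → LineModelOn Nb A → LineModelOn Nb′ A
model-cong Nb⇔Nb′ (σ , f) = σ , λ x → proj₁ (f x) , λ v →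
  ⇔-trans (⇔-sym (Nb⇔Nb′ x v)) (proj₂ (f x) v)

-- Adding the centre x to every neighbourhood costs one extra order: the
-- identity order, where {x} is the interval from x to x.
add-centre : ∀ {n} {Nb : Fin n → Fin n → Set} {p : ℕ} →
  LineModel Nb p → LineModel (λ x v → Nb x v ⊎ v ≡ x) (suc p)
add-centre {n} {Nb} {p} (σ , f) = σ′ , λ x → I′ x , λ v → mk⇔ (cover x v) (covered x v)
  where
  σ′ : Fin (suc p) → LinOrder n
  σ′ Fin.zero    = Permutation.id
  σ′ (Fin.suc i) = σ i
  I′ : Fin n → Fin (suc p) → Interval n
  I′ x Fin.zero    = just (x , x)
  I′ x (Fin.suc i) = proj₁ (f x) i
  cover : ∀ x v → Nb x v ⊎ v ≡ x → ∃ λ k → v ∈I[ σ′ k , I′ x k ]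
  cover x v (inj₁ nb)   = let (i , m) = to (proj₂ (f x) v) nb in Fin.suc i , m
  cover x v (inj₂ refl) = Fin.zero , ≤-refl , ≤-refl
  covered : ∀ x v → (∃ λ k → v ∈I[ σ′ k , I′ x k ]) → Nb x v ⊎ v ≡ x
  covered x v (Fin.zero , x≤v , v≤x) = inj₂ (toℕ-injective (≤-antisym v≤x x≤v))
  covered x v (Fin.suc i , m)         = inj₁ (from (proj₂ (f x) v) (i , m))

-- Removing the centre x from every neighbourhood at most doubles the number
-- of orders: each order is used twice, with every interval punctured at x.
remove-centre : ∀ {n} {Nb : Fin n → Fin n → Set} {A : Set} →
  LineModelOn Nb A → LineModelOn (λ x v → Nb x v × ¬ v ≡ x) (A ⊎ A)
remove-centre {n} {Nb} {A} (σ , f) = σ′ , λ x → I′ x , λ v → mk⇔ (cover x v) (covered x v)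
  where
  σ′ : A ⊎ A → LinOrder n
  σ′ (inj₁ i) = σ i
  σ′ (inj₂ i) = σ i
  I′ : Fin n → A ⊎ A → Interval n
  I′ x (inj₁ i) = before (proj₁ (f x) i) (pos (σ i) x)
  I′ x (inj₂ i) = after  (proj₁ (f x) i) (pos (σ i) x)
  cover : ∀ x v → Nb x v × ¬ v ≡ x → ∃ λ k → v ∈I[ σ′ k , I′ x k ]
  cover x v (nb , v≢x) with to (proj₂ (f x) v) nb
  ... | i , m with to (puncture (σ i) (proj₁ (f x) i) _ v) (m , λ eq → v≢x (pos-injective (σ i) eq))
  ...   | inj₁ w = inj₁ i , w
  ...   | inj₂ w = inj₂ i , w
  covered : ∀ x v → (∃ λ k → v ∈I[ σ′ k , I′ x k ]) → Nb x v × ¬ v ≡ x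
  covered x v (k , w) = let (i , m , pos≢) = unpuncture k w in
    from (proj₂ (f x) v) (i , m) , λ { refl → pos≢ refl }
    where
    unpuncture : ∀ k → v ∈I[ σ′ k , I′ x k ] →
      ∃ λ i → v ∈I[ σ i , proj₁ (f x) i ] × ¬ pos (σ i) v ≡ pos (σ i) x
    unpuncture (inj₁ i) w = i , from (puncture (σ i) _ _ v) (inj₁ w)
    unpuncture (inj₂ i) w = i , from (puncture (σ i) _ _ v) (inj₂ w)

open-is-punctured-closed : ∀ {n} (G : Graph n) x v →
  (Nc[ G ] x ∋ v × ¬ v ≡ x) ⇔ N[ G ] x ∋ v
open-is-punctured-closed G x v = mk⇔ drop (λ adj → inj₁ adj , λ { refl → Graph.irrefl G x adj })
  where
  drop : Nc[ G ] x ∋ v × ¬ v ≡ x → N[ G ] x ∋ v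
  drop (inj₁ adj , _)    = adj
  drop (inj₂ v≡x , v≢x) = ⊥-elim (v≢x v≡x)

closed-from-open : ∀ {n} (G : Graph n) (p : ℕ) → OpenLineModel G p → ClosedLineModel G (suc p)
closed-from-open G p = add-centre

open-from-closed : ∀ {n} (G : Graph n) (p : ℕ) → ClosedLineModel G p → OpenLineModel G (p + p)
open-from-closed G p M =
  reindex (splitAt p) (join p p) (splitAt-join p p)
    (model-cong (open-is-punctured-closed G) (remove-centre M))

lemma1 : ∀ (n : ℕ) (G : Graph n) (l lo : ℕ) →
    IsLin G l → IsOpenLin G lo → (l ∸ 1 ≤ lo) × (lo ≤ 2 * l)
lemma1 n G l lo (closedModel , lin-minimal) (openModel , openLin-minimal) =
  ∸-monoˡ-≤ 1 (lin-minimal (suc lo) (closed-from-open G lo openModel)) ,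
  openLin-minimal (2 * l)
    (subst (OpenLineModel G) (cong (l +_) (sym (+-identityʳ l))) (open-from-closed G l closedModel))
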